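{- Let $B_n(x)$ denote the Bernoulli polynomials. The following polynomial identities in $x$ hold. (1) For $m\in\mathbb N$ and $\nu\in\mathbb N_0$ with $0\le \nu\le m$, $$\sum_{\substack{k=0\\ k+m\ \text{odd}}}^{m-1}\binom mk \binom{k+m}{\nu}\binom{k+m-\nu}{m-\nu}B_k(x) =\frac12\sum_{j=0}^{m-1}(-1)^{j+m+1}\binom m{j+1}\binom{j+m}{\nu}\binom{j+m-\nu}{m-\nu}(j+m+1)x^{j}.$$ (2) For $m\in\mathbb N$ and $0\le \nu\le m-1$, $$\sum_{\substack{k=0\\ k+m\ \text{odd}}}^{m-1}\binom mk \binom{k+m}{\nu}\binom{k+m-\nu}{m-\nu-1}B_{k+1}(x) =\frac12\sum_{j=0}^{m}(-1)^{j+m}\binom m{j}\binom{j+m-1}{\nu}\binom{j+m-\nu-1}{m-\nu-1}(j+m)x^{j}.$$ (3) For $m\in\mathbb N$, $0\le \nu\le m-1$ and $0\le \ell\le m-\nu-1$, $$\sum_{\substack{k=0\\ k+m\ \text{odd}}}^{m-1}\binom mk \binom{k+m}{\nu}\binom{k+m-\nu}{\ell}B_{k+m-\nu-\ell}(x) =\frac12\sum_{j=0}^{m}(-1)^{j+m}\binom m{j}\binom{j+m-1}{\nu}\binom{j+m-\nu-1}{\ell}(j+m)x^{j+m-\nu-\ell-1}.$$ (4) For $m\in\mathbb N$, $0\le \nu\le m$ and $0\le \ell\le m-1$, $$\sum_{\substack{k=\ell\\ k+m\ \text{odd}}}^{m-1}\binom mk \binom{k+m}{\nu}\binom{k+m-\nu}{\ell+m-\nu}B_{k-\ell}(x)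 =\frac12\sum_{j=\ell}^{m-1}(-1)^{j+m+1}\binom m{j+1}\binom{j+m}{\nu}\binom{j+m-\nu}{\ell+m-\nu}(j+m+1)x^{j-\ell}.$$
   Context: $\mathbb N=\{1,2,\dots\}$, $\mathbb N_0=\mathbb N\cup\{0\}$. The Bernoulli polynomials $B_n(x)$ are defined by the generating function $\frac{te^{xt}}{e^t-1}=\sum_{n\ge0}B_n(x)\frac{t^n}{n!}$. The notation $\sum_{k+m\ \text{odd}}$ means the sum runs only over those $k$ in the indicated range for which $k+m$ is odd. -}

module Defs where

open import Data.Bool using (Bool; true; false; if_then_else_)
open import Data.Nat as ℕ using (ℕ; zero; suc; _∸_)
open import Data.Nat.Combinatorics using (_C_)
open import Data.Integer using (+_)
open import Data.List using (List; []; _∷_; _++_; [_])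
open import Data.Rational using (ℚ; 0ℚ; 1ℚ; _+_; _*_; -_; _/_)

ℕ→ℚ : ℕ → ℚ
ℕ→ℚ n = + n / 1

_^ℚ_ : ℚ → ℕ → ℚ
x ^ℚ zero  = 1ℚ
x ^ℚ suc n = x * (x ^ℚ n)

isOdd : ℕ → Bool
isOdd zero          = false
isOdd (suc zero)    = true
isOdd (suc (suc n)) = isOdd n

sgn : ℕ → ℚ
sgn n = if isOdd n then - 1ℚ else 1ℚ

binom : ℕ → ℕ → ℚ
binom n k = ℕ→ℚ (n C k)

Σ< : ℕ → (ℕ → ℚ) → ℚ
Σ< zero    f = 0ℚ
Σ< (suc n) f = Σ< n f + f n

-- Σ_{k=a}^{b} f k  (empty if b < a)
ΣFromTo : ℕ → ℕ → (ℕ → ℚ) → ℚ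
ΣFromTo a b f = Σ< (suc b ∸ a) (λ i → f (a ℕ.+ i))

ΣOdd : ℕ → ℕ → ℕ → (ℕ → ℚ) → ℚ
ΣOdd m a b f = ΣFromTo a b (λ k → if isOdd (k ℕ.+ m) then f k else 0ℚ)

nth : List ℚ → ℕ → ℚ
nth []       _       = 0ℚ
nth (x ∷ xs) zero    = x
nth (x ∷ xs) (suc n) = nth xs n

-- Bernoulli numbers B_0, ..., B_{n-1} (convention B_1 = -1/2, i.e. B_n = B_n(0)
-- for te^{xt}/(e^t-1)), via the recurrence  Σ_{k=0}^{n} C(n+1,k) B_k = 0 (n ≥ 1),
-- which is equivalent to the generating function t/(e^t-1) = Σ B_n t^n/n!.
nextBern : ℕ → List ℚ → ℚ
nextBern zero    bs = 1ℚ
nextBern (suc n) bs =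
  - ((+ 1 / (suc (suc n))) * Σ< (suc n) (λ k → binom (suc (suc n)) k * nth bs k))

bernList : ℕ → List ℚ
bernList zero    = []
bernList (suc n) = bernList n ++ [ nextBern n (bernList n) ]

bernNum : ℕ → ℚ
bernNum n = nth (bernList (suc n)) n

-- Bernoulli polynomial B_n(x) = Σ_{k=0}^{n} C(n,k) B_k x^{n-k}
-- (equivalent to the generating function te^{xt}/(e^t-1) = Σ B_n(x) t^n/n!)
B : ℕ → ℚ → ℚ
B n x = Σ< (suc n) (λ k → binom n k * bernNum k * (x ^ℚ (n ∸ k)))

-- Write n = j + m.  The absorption identity C(n-1,r)·n = C(n,r)·(n-r) and
-- B_d(x+1) - B_d(x) = d x^(d-1) turn the right-hand side of the basic identity
--   Σ_{k<m, k+m odd} C(m,k) C(k+m,r) B_{k+m-r}(x)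
--     = ½ Σ_{j≤m} (-1)^(j+m) C(m,j) C(j+m-1,r) (j+m) x^(j+m-1-r)
-- into ½ Σ_j (-1)^(j+m) C(m,j) C(j+m,r) (B_{n-r}(x+1) - B_{n-r}(x)).  Expanding
-- B_{n-r}(x+1) = Σ_i C(n-r,i) B_i(x), the sum over j becomes the m-th finite
-- difference of s ↦ C(s,r+i) at s = m, which is C(m, r+i-m); re-indexing, the
-- B(x+1)-part is Σ_{q≤m} w_q and the B(x)-part is Σ_q (-1)^(q+m) w_q, where
-- w_q = C(m,q) C(q+m,r) B_{q+m-r}(x).  Their half-difference keeps exactly the
-- terms with q+m odd.  The four identities of the theorem follow by writing
-- C(n,ν) C(n-ν,L) = C(ν+L,ν) C(n,ν+L) and taking r = ν+L.
module Submission where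

open import Data.Bool using (Bool; true; false; if_then_else_)
open import Data.Empty using (⊥-elim)
import Data.Integer as ℤ
import Data.Integer.Properties as ℤₚ
open import Data.List using (List; []; _∷_; _++_; [_]; length)
open import Data.List.Properties using (length-++)
open import Data.Nat as ℕ using (ℕ; zero; suc; _∸_; _≤_; _<_; z≤n; s≤s; _≡ᵇ_; _!)
open import Data.Nat.Properties using (_!≢0; _!*_!≢0)
open import Data.Nat.Combinatorics
  using (_C_; k![n∸k]!∣n!; nCk≡n!/k![n-k]!; k>n⇒nCk≡0;
         nCk≡nC[n∸k]; nCk+nC[k+1]≡[n+1]C[k+1]; nC1≡n; nCn≡1)
open import Data.Nat.Divisibility using (divides)
open import Data.Nat.DivMod using (_/_; m*n/n≡m)
import Data.Nat.Properties as ℕₚ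
import Data.Nat.Solver as ℕ-Solver
open import Data.Product using (_×_; _,_)
open import Data.Rational using (ℚ; 0ℚ; 1ℚ; _+_; _*_; -_; _-_; ½; toℚᵘ)
  renaming (_/_ to _/ℚ_)
open import Data.Rational.Properties
import Data.Rational.Unnormalised as ℚᵘ
import Data.Rational.Unnormalised.Properties as ℚᵘₚ
open import Data.Rational.Solver using (module +-*-Solver)
open import Data.Sum using (inj₁; inj₂; [_,_]′)
open import Relation.Binary.PropositionalEquality hiding ([_])
open import Relation.Nullary using (yes; no)

open import Defs

toℚᵘ-ℕ→ℚ : ∀ n → toℚᵘ (ℕ→ℚ n) ℚᵘ.≃ ℚᵘ.mkℚᵘ (ℤ.+ n) 0
toℚᵘ-ℕ→ℚ n = toℚᵘ-fromℚᵘ (ℚᵘ.mkℚᵘ (ℤ.+ n) 0)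

ℕ→ℚ-+ : ∀ a b → ℕ→ℚ (a ℕ.+ b) ≡ ℕ→ℚ a + ℕ→ℚ b
ℕ→ℚ-+ a b = toℚᵘ-injective (ℚᵘₚ.≃-trans (toℚᵘ-ℕ→ℚ (a ℕ.+ b)) (ℚᵘₚ.≃-trans sum
  (ℚᵘₚ.≃-sym (ℚᵘₚ.≃-trans (toℚᵘ-homo-+ (ℕ→ℚ a) (ℕ→ℚ b)) (ℚᵘₚ.+-cong (toℚᵘ-ℕ→ℚ a) (toℚᵘ-ℕ→ℚ b))))))
  where
  sum : ℚᵘ.mkℚᵘ (ℤ.+ (a ℕ.+ b)) 0 ℚᵘ.≃ ℚᵘ.mkℚᵘ (ℤ.+ a) 0 ℚᵘ.+ ℚᵘ.mkℚᵘ (ℤ.+ b) 0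
  sum = ℚᵘ.*≡* (cong (ℤ._* ℤ.+ 1) (cong₂ ℤ._+_ (sym (ℤₚ.*-identityʳ (ℤ.+ a))) (sym (ℤₚ.*-identityʳ (ℤ.+ b)))))

ℕ→ℚ-* : ∀ a b → ℕ→ℚ (a ℕ.* b) ≡ ℕ→ℚ a * ℕ→ℚ b
ℕ→ℚ-* a b = toℚᵘ-injective (ℚᵘₚ.≃-trans (toℚᵘ-ℕ→ℚ (a ℕ.* b)) (ℚᵘₚ.≃-trans product
  (ℚᵘₚ.≃-sym (ℚᵘₚ.≃-trans (toℚᵘ-homo-* (ℕ→ℚ a) (ℕ→ℚ b)) (ℚᵘₚ.*-cong (toℚᵘ-ℕ→ℚ a) (toℚᵘ-ℕ→ℚ b))))))
  where
  product : ℚᵘ.mkℚᵘ (ℤ.+ (a ℕ.* b)) 0 ℚᵘ.≃ ℚᵘ.mkℚᵘ (ℤ.+ a) 0 ℚᵘ.* ℚᵘ.mkℚᵘ (ℤ.+ b) 0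
  product = ℚᵘ.*≡* (cong (ℤ._* ℤ.+ 1) (ℤₚ.pos-* a b))

ℕ→ℚ-*-1/ : ∀ n → ℕ→ℚ (suc n) * (ℤ.+ 1 /ℚ suc n) ≡ 1ℚ
ℕ→ℚ-*-1/ n = toℚᵘ-injective (ℚᵘₚ.≃-trans (toℚᵘ-homo-* (ℕ→ℚ (suc n)) (ℤ.+ 1 /ℚ suc n))
  (ℚᵘₚ.≃-trans (ℚᵘₚ.*-cong (toℚᵘ-ℕ→ℚ (suc n)) (toℚᵘ-fromℚᵘ (ℚᵘ.mkℚᵘ (ℤ.+ 1) n)))
    (ℚᵘ.*≡* (cong (λ k → ℤ.+ suc k) (trans (ℕₚ.*-identityʳ (n ℕ.* 1))
      (trans (ℕₚ.*-identityʳ n) (sym (trans (ℕₚ.+-identityʳ (n ℕ.+ 0)) (ℕₚ.+-identityʳ n)))))))))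

m∸n∸o≡m∸o∸n : ∀ m n o → m ∸ n ∸ o ≡ m ∸ o ∸ n
m∸n∸o≡m∸o∸n m n o =
  trans (ℕₚ.∸-+-assoc m n o) (trans (cong (m ∸_) (ℕₚ.+-comm n o)) (sym (ℕₚ.∸-+-assoc m o n)))

nCk*[k!*[n∸k]!]≡n! : ∀ {n k} → k ≤ n → (n C k) ℕ.* (k ! ℕ.* (n ∸ k) !) ≡ n !
nCk*[k!*[n∸k]!]≡n! {n} {k} k≤n with k![n∸k]!∣n! k≤n
... | divides q n!≡q*d = begin
  (n C k) ℕ.* d      ≡⟨ cong (ℕ._* d) (nCk≡n!/k![n-k]! k≤n) ⟩
  (n ! / d) ℕ.* d    ≡⟨ cong (λ z → (z / d) ℕ.* d) n!≡q*d ⟩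
  (q ℕ.* d / d) ℕ.* d ≡⟨ cong (ℕ._* d) (m*n/n≡m q d) ⟩
  q ℕ.* d            ≡⟨ sym n!≡q*d ⟩
  n !                ∎
  where
  open ≡-Reasoning
  d = k ! ℕ.* (n ∸ k) !
  instance _ = k !* (n ∸ k) !≢0

nCa*[n∸a]Cb≡[a+b]Ca*nC[a+b] : ∀ n a b → (n C a) ℕ.* ((n ∸ a) C b) ≡ ((a ℕ.+ b) C a) ℕ.* (n C (a ℕ.+ b))
nCa*[n∸a]Cb≡[a+b]Ca*nC[a+b] n a b with a ℕₚ.≤? n
... | no a≰n = begin
  (n C a) ℕ.* ((n ∸ a) C b)           ≡⟨ cong (ℕ._* ((n ∸ a) C b)) (k>n⇒nCk≡0 n<a) ⟩
  0                                   ≡⟨ sym (ℕₚ.*-zeroʳ ((a ℕ.+ b) C a)) ⟩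
  ((a ℕ.+ b) C a) ℕ.* 0               ≡⟨ cong (((a ℕ.+ b) C a) ℕ.*_) (sym (k>n⇒nCk≡0 (ℕₚ.<-≤-trans n<a (ℕₚ.m≤m+n a b)))) ⟩
  ((a ℕ.+ b) C a) ℕ.* (n C (a ℕ.+ b)) ∎
  where
  open ≡-Reasoning
  n<a = ℕₚ.≰⇒> a≰n
... | yes a≤n with b ℕₚ.≤? n ∸ a
...   | no b≰n∸a = begin
  (n C a) ℕ.* ((n ∸ a) C b)           ≡⟨ cong ((n C a) ℕ.*_) (k>n⇒nCk≡0 (ℕₚ.≰⇒> b≰n∸a)) ⟩
  (n C a) ℕ.* 0                       ≡⟨ ℕₚ.*-zeroʳ (n C a) ⟩
  0                                   ≡⟨ sym (ℕₚ.*-zeroʳ ((a ℕ.+ b) C a)) ⟩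
  ((a ℕ.+ b) C a) ℕ.* 0               ≡⟨ cong (((a ℕ.+ b) C a) ℕ.*_) (sym (k>n⇒nCk≡0 n<a+b)) ⟩
  ((a ℕ.+ b) C a) ℕ.* (n C (a ℕ.+ b)) ∎
  where
  open ≡-Reasoning
  n<a+b : n < a ℕ.+ b
  n<a+b = subst (_< a ℕ.+ b) (ℕₚ.m+[n∸m]≡n a≤n) (ℕₚ.+-monoʳ-< a (ℕₚ.≰⇒> b≰n∸a))
...   | yes b≤n∸a = ℕₚ.*-cancelʳ-≡ _ _ F (begin
  (n C a) ℕ.* ((n ∸ a) C b) ℕ.* F
    ≡⟨ solve 5 (λ x y p q s → x :* y :* (p :* q :* s) := x :* (p :* (y :* (q :* s)))) refl
         (n C a) ((n ∸ a) C b) (a !) (b !) (c !) ⟩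
  (n C a) ℕ.* (a ! ℕ.* (((n ∸ a) C b) ℕ.* (b ! ℕ.* c !)))
    ≡⟨ cong (λ z → (n C a) ℕ.* (a ! ℕ.* z)) choose-rest ⟩
  (n C a) ℕ.* (a ! ℕ.* (n ∸ a) !)               ≡⟨ nCk*[k!*[n∸k]!]≡n! a≤n ⟩
  n !                                           ≡⟨ sym (nCk*[k!*[n∸k]!]≡n! a+b≤n) ⟩
  (n C (a ℕ.+ b)) ℕ.* ((a ℕ.+ b) ! ℕ.* c !)
    ≡⟨ cong (λ z → (n C (a ℕ.+ b)) ℕ.* (z ℕ.* c !)) (sym choose-part) ⟩
  (n C (a ℕ.+ b)) ℕ.* (((a ℕ.+ b) C a) ℕ.* (a ! ℕ.* b !) ℕ.* c !)
    ≡⟨ solve 5 (λ x y p q s → x :* (y :* (p :* q) :* s) := y :* x :* (p :* q :* s)) refl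
         (n C (a ℕ.+ b)) ((a ℕ.+ b) C a) (a !) (b !) (c !) ⟩
  ((a ℕ.+ b) C a) ℕ.* (n C (a ℕ.+ b)) ℕ.* F ∎)
  where
  open ≡-Reasoning
  open ℕ-Solver.+-*-Solver
  c = n ∸ (a ℕ.+ b)
  F = a ! ℕ.* b ! ℕ.* c !
  instance _ = ℕₚ.m*n≢0 (a ! ℕ.* b !) (c !) {{a !* b !≢0}} {{c !≢0}}
  a+b≤n : a ℕ.+ b ≤ n
  a+b≤n = subst (a ℕ.+ b ≤_) (ℕₚ.m+[n∸m]≡n a≤n) (ℕₚ.+-monoʳ-≤ a b≤n∸a)
  choose-rest : ((n ∸ a) C b) ℕ.* (b ! ℕ.* c !) ≡ (n ∸ a) !
  choose-rest = subst (λ z → ((n ∸ a) C b) ℕ.* (b ! ℕ.* z !) ≡ (n ∸ a) !)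
                      (ℕₚ.∸-+-assoc n a b) (nCk*[k!*[n∸k]!]≡n! b≤n∸a)
  choose-part : ((a ℕ.+ b) C a) ℕ.* (a ! ℕ.* b !) ≡ (a ℕ.+ b) !
  choose-part = subst (λ z → ((a ℕ.+ b) C a) ℕ.* (a ! ℕ.* z !) ≡ (a ℕ.+ b) !)
                      (ℕₚ.m+n∸m≡n a b) (nCk*[k!*[n∸k]!]≡n! (ℕₚ.m≤m+n a b))

[n∸1]Cr*n≡nCr*[n∸r] : ∀ n r → ((n ∸ 1) C r) ℕ.* n ≡ (n C r) ℕ.* (n ∸ r)
[n∸1]Cr*n≡nCr*[n∸r] zero r =
  trans (ℕₚ.*-zeroʳ (0 C r)) (sym (trans (cong ((0 C r) ℕ.*_) (ℕₚ.0∸n≡0 r)) (ℕₚ.*-zeroʳ (0 C r))))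
[n∸1]Cr*n≡nCr*[n∸r] (suc n) r = begin
  (n C r) ℕ.* suc n                     ≡⟨ ℕₚ.*-comm (n C r) (suc n) ⟩
  suc n ℕ.* (n C r)                     ≡⟨ cong (ℕ._* (n C r)) (sym (nC1≡n (suc n))) ⟩
  (suc n C 1) ℕ.* ((suc n ∸ 1) C r)      ≡⟨ nCa*[n∸a]Cb≡[a+b]Ca*nC[a+b] (suc n) 1 r ⟩
  (suc r C 1) ℕ.* (suc n C suc r)       ≡⟨ cong (ℕ._* (suc n C suc r)) (trans (nC1≡n (suc r)) (sym [1+r]Cr≡1+r)) ⟩
  (suc r C r) ℕ.* (suc n C suc r)       ≡⟨ cong (λ z → (z C r) ℕ.* (suc n C z)) (ℕₚ.+-comm 1 r) ⟩
  ((r ℕ.+ 1) C r) ℕ.* (suc n C (r ℕ.+ 1)) ≡⟨ sym (nCa*[n∸a]Cb≡[a+b]Ca*nC[a+b] (suc n) r 1) ⟩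
  (suc n C r) ℕ.* ((suc n ∸ r) C 1)     ≡⟨ cong ((suc n C r) ℕ.*_) (nC1≡n (suc n ∸ r)) ⟩
  (suc n C r) ℕ.* (suc n ∸ r)           ∎
  where
  open ≡-Reasoning
  [1+r]Cr≡1+r : (suc r C r) ≡ suc r
  [1+r]Cr≡1+r = trans (nCk≡nC[n∸k] (ℕₚ.n≤1+n r)) (trans (cong (suc r C_) (ℕₚ.m+n∸n≡m 1 r)) (nC1≡n (suc r)))

binom-vanish : ∀ {n k} → n < k → binom n k ≡ 0ℚ
binom-vanish n<k = cong ℕ→ℚ (k>n⇒nCk≡0 n<k)

binom-n-n : ∀ n → binom n n ≡ 1ℚ
binom-n-n n = cong ℕ→ℚ (nCn≡1 n)

binom-1+n-n : ∀ n → binom (suc n) n ≡ ℕ→ℚ (suc n)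
binom-1+n-n n = cong ℕ→ℚ (trans (nCk≡nC[n∸k] (ℕₚ.n≤1+n n)) (trans (cong (suc n C_) (ℕₚ.m+n∸n≡m 1 n)) (nC1≡n (suc n))))

binom-sym : ∀ {n k} → k ≤ n → binom n k ≡ binom n (n ∸ k)
binom-sym k≤n = cong ℕ→ℚ (nCk≡nC[n∸k] k≤n)

binom-pascal : ∀ n k → binom (suc n) (suc k) ≡ binom n k + binom n (suc k)
binom-pascal n k = trans (cong ℕ→ℚ (sym (nCk+nC[k+1]≡[n+1]C[k+1] n k))) (ℕ→ℚ-+ (n C k) (n C suc k))

binom-subset : ∀ n a b → binom n a * binom (n ∸ a) b ≡ binom (a ℕ.+ b) a * binom n (a ℕ.+ b)
binom-subset n a b = trans (sym (ℕ→ℚ-* (n C a) ((n ∸ a) C b)))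
  (trans (cong ℕ→ℚ (nCa*[n∸a]Cb≡[a+b]Ca*nC[a+b] n a b)) (ℕ→ℚ-* ((a ℕ.+ b) C a) (n C (a ℕ.+ b))))

binom-subset-vanish : ∀ {n a b} → n < a ℕ.+ b → binom n a * binom (n ∸ a) b ≡ 0ℚ
binom-subset-vanish {n} {a} {b} n<a+b =
  trans (binom-subset n a b) (trans (cong (binom (a ℕ.+ b) a *_) (binom-vanish n<a+b)) (*-zeroʳ (binom (a ℕ.+ b) a)))

binom-absorb : ∀ n r → binom (n ∸ 1) r * ℕ→ℚ n ≡ binom n r * ℕ→ℚ (n ∸ r)
binom-absorb n r = trans (sym (ℕ→ℚ-* ((n ∸ 1) C r) n))
  (trans (cong ℕ→ℚ ([n∸1]Cr*n≡nCr*[n∸r] n r)) (ℕ→ℚ-* (n C r) (n ∸ r)))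

open +-*-Solver

Σ<-cong< : ∀ n {f g : ℕ → ℚ} → (∀ i → i < n → f i ≡ g i) → Σ< n f ≡ Σ< n g
Σ<-cong< zero    f≗g = refl
Σ<-cong< (suc n) f≗g = cong₂ _+_ (Σ<-cong< n (λ i i<n → f≗g i (ℕₚ.m<n⇒m<1+n i<n))) (f≗g n ℕₚ.≤-refl)

Σ<-cong : ∀ n {f g : ℕ → ℚ} → (∀ i → f i ≡ g i) → Σ< n f ≡ Σ< n g
Σ<-cong n f≗g = Σ<-cong< n (λ i _ → f≗g i)

Σ<-0 : ∀ n {f : ℕ → ℚ} → (∀ i → i < n → f i ≡ 0ℚ) → Σ< n f ≡ 0ℚ
Σ<-0 zero    f≗0 = refl
Σ<-0 (suc n) f≗0 = cong₂ _+_ (Σ<-0 n (λ i i<n → f≗0 i (ℕₚ.m<n⇒m<1+n i<n))) (f≗0 n ℕₚ.≤-refl)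

Σ<-distrib-+ : ∀ n (f g : ℕ → ℚ) → Σ< n (λ i → f i + g i) ≡ Σ< n f + Σ< n g
Σ<-distrib-+ zero    f g = refl
Σ<-distrib-+ (suc n) f g = trans (cong (_+ (f n + g n)) (Σ<-distrib-+ n f g))
  (solve 4 (λ a b c d → (a :+ b) :+ (c :+ d) := (a :+ c) :+ (b :+ d)) refl (Σ< n f) (Σ< n g) (f n) (g n))

*-distribˡ-Σ< : ∀ n (c : ℚ) (f : ℕ → ℚ) → c * Σ< n f ≡ Σ< n (λ i → c * f i)
*-distribˡ-Σ< zero    c f = *-zeroʳ c
*-distribˡ-Σ< (suc n) c f = trans (*-distribˡ-+ c (Σ< n f) (f n)) (cong (_+ c * f n) (*-distribˡ-Σ< n c f))

*-distribʳ-Σ< : ∀ n (c : ℚ) (f : ℕ → ℚ) → Σ< n f * c ≡ Σ< n (λ i → f i * c)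
*-distribʳ-Σ< n c f = trans (*-comm (Σ< n f) c) (trans (*-distribˡ-Σ< n c f) (Σ<-cong n (λ i → *-comm c (f i))))

neg-distrib-Σ< : ∀ n (f : ℕ → ℚ) → - Σ< n f ≡ Σ< n (λ i → - f i)
neg-distrib-Σ< n f = trans (solve 1 (λ s → :- s := con (- 1ℚ) :* s) refl (Σ< n f))
  (trans (*-distribˡ-Σ< n (- 1ℚ) f) (Σ<-cong n (λ i → solve 1 (λ a → con (- 1ℚ) :* a := :- a) refl (f i))))

Σ<-split : ∀ a b (f : ℕ → ℚ) → Σ< (a ℕ.+ b) f ≡ Σ< a f + Σ< b (λ i → f (a ℕ.+ i))
Σ<-split a zero    f = trans (cong (λ n → Σ< n f) (ℕₚ.+-identityʳ a)) (sym (+-identityʳ (Σ< a f)))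
Σ<-split a (suc b) f = begin
  Σ< (a ℕ.+ suc b) f                                    ≡⟨ cong (λ n → Σ< n f) (ℕₚ.+-suc a b) ⟩
  Σ< (a ℕ.+ b) f + f (a ℕ.+ b)                          ≡⟨ cong (_+ f (a ℕ.+ b)) (Σ<-split a b f) ⟩
  Σ< a f + Σ< b (λ i → f (a ℕ.+ i)) + f (a ℕ.+ b)        ≡⟨ +-assoc (Σ< a f) _ (f (a ℕ.+ b)) ⟩
  Σ< a f + (Σ< b (λ i → f (a ℕ.+ i)) + f (a ℕ.+ b))      ∎
  where open ≡-Reasoning

Σ<-suc-head : ∀ n (f : ℕ → ℚ) → Σ< (suc n) f ≡ f 0 + Σ< n (λ i → f (suc i))
Σ<-suc-head n f = trans (Σ<-split 1 n f) (cong (_+ Σ< n (λ i → f (suc i))) (+-identityˡ (f 0)))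

Σ<-vanishing-tail : ∀ {a b} (f : ℕ → ℚ) → a ≤ b → (∀ i → a ≤ i → f i ≡ 0ℚ) → Σ< b f ≡ Σ< a f
Σ<-vanishing-tail {a} {b} f a≤b tail≗0 = begin
  Σ< b f                                     ≡⟨ cong (λ n → Σ< n f) (sym (ℕₚ.m+[n∸m]≡n a≤b)) ⟩
  Σ< (a ℕ.+ (b ∸ a)) f                       ≡⟨ Σ<-split a (b ∸ a) f ⟩
  Σ< a f + Σ< (b ∸ a) (λ i → f (a ℕ.+ i))    ≡⟨ cong (Σ< a f +_) (Σ<-0 (b ∸ a) (λ i _ → tail≗0 (a ℕ.+ i) (ℕₚ.m≤m+n a i))) ⟩
  Σ< a f + 0ℚ                                ≡⟨ +-identityʳ (Σ< a f) ⟩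
  Σ< a f                                     ∎
  where open ≡-Reasoning

Σ<-vanishing-head : ∀ {a n} (f : ℕ → ℚ) → a ≤ n → (∀ i → i < a → f i ≡ 0ℚ) →
                    Σ< n f ≡ Σ< (n ∸ a) (λ i → f (a ℕ.+ i))
Σ<-vanishing-head {a} {n} f a≤n head≗0 = begin
  Σ< n f                                     ≡⟨ cong (λ k → Σ< k f) (sym (ℕₚ.m+[n∸m]≡n a≤n)) ⟩
  Σ< (a ℕ.+ (n ∸ a)) f                       ≡⟨ Σ<-split a (n ∸ a) f ⟩
  Σ< a f + Σ< (n ∸ a) (λ i → f (a ℕ.+ i))    ≡⟨ cong (_+ Σ< (n ∸ a) (λ i → f (a ℕ.+ i))) (Σ<-0 a head≗0) ⟩
  0ℚ + Σ< (n ∸ a) (λ i → f (a ℕ.+ i))        ≡⟨ +-identityˡ _ ⟩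
  Σ< (n ∸ a) (λ i → f (a ℕ.+ i))             ∎
  where open ≡-Reasoning

Σ<-comm : ∀ n m (f : ℕ → ℕ → ℚ) → Σ< n (λ i → Σ< m (f i)) ≡ Σ< m (λ j → Σ< n (λ i → f i j))
Σ<-comm zero    m f = sym (Σ<-0 m (λ _ _ → refl))
Σ<-comm (suc n) m f = trans (cong (_+ Σ< m (f n)) (Σ<-comm n m f))
                            (sym (Σ<-distrib-+ m (λ j → Σ< n (λ i → f i j)) (f n)))

Σ<-reverse : ∀ n (f : ℕ → ℚ) → Σ< (suc n) f ≡ Σ< (suc n) (λ i → f (n ∸ i))
Σ<-reverse zero    f = refl
Σ<-reverse (suc n) f = begin
  Σ< (suc n) f + f (suc n)                         ≡⟨ cong (_+ f (suc n)) (Σ<-reverse n f) ⟩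
  Σ< (suc n) (λ i → f (n ∸ i)) + f (suc n)         ≡⟨ +-comm _ (f (suc n)) ⟩
  f (suc n) + Σ< (suc n) (λ i → f (n ∸ i))         ≡⟨ sym (Σ<-suc-head (suc n) (λ i → f (suc n ∸ i))) ⟩
  Σ< (suc (suc n)) (λ i → f (suc n ∸ i))           ∎
  where open ≡-Reasoning

≡ᵇ-refl : ∀ n → (n ≡ᵇ n) ≡ true
≡ᵇ-refl zero    = refl
≡ᵇ-refl (suc n) = ≡ᵇ-refl n

≢⇒≡ᵇ≡false : ∀ m n → m ≢ n → (m ≡ᵇ n) ≡ false
≢⇒≡ᵇ≡false zero    zero    m≢n = ⊥-elim (m≢n refl)
≢⇒≡ᵇ≡false zero    (suc n) m≢n = refl
≢⇒≡ᵇ≡false (suc m) zero    m≢n = refl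
≢⇒≡ᵇ≡false (suc m) (suc n) m≢n = ≢⇒≡ᵇ≡false m n (λ m≡n → m≢n (cong suc m≡n))

≡ᵇ-sym : ∀ m n → (m ≡ᵇ n) ≡ (n ≡ᵇ m)
≡ᵇ-sym zero    zero    = refl
≡ᵇ-sym zero    (suc n) = refl
≡ᵇ-sym (suc m) zero    = refl
≡ᵇ-sym (suc m) (suc n) = ≡ᵇ-sym m n

≡ᵇ-cancelˡ-+ : ∀ r m n → (r ℕ.+ m ≡ᵇ r ℕ.+ n) ≡ (m ≡ᵇ n)
≡ᵇ-cancelˡ-+ zero    m n = refl
≡ᵇ-cancelˡ-+ (suc r) m n = ≡ᵇ-cancelˡ-+ r m n

Σ<-δ-out : ∀ {N d} (G : ℕ → ℚ) → N ≤ d → Σ< N (λ q → if q ≡ᵇ d then G q else 0ℚ) ≡ 0ℚ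
Σ<-δ-out {N} {d} G N≤d = Σ<-0 N (λ q q<N →
  cong (if_then G q else 0ℚ) (≢⇒≡ᵇ≡false q d (λ q≡d → ℕₚ.<⇒≢ (ℕₚ.<-≤-trans q<N N≤d) q≡d)))

Σ<-δ : ∀ {N d} (G : ℕ → ℚ) → d < N → Σ< N (λ q → if q ≡ᵇ d then G q else 0ℚ) ≡ G d
Σ<-δ {suc n} {d} G d<1+n with ℕₚ.m≤n⇒m<n∨m≡n (ℕₚ.≤-pred d<1+n)
... | inj₁ d<n = trans (cong₂ _+_ (Σ<-δ G d<n)
                         (cong (if_then G n else 0ℚ) (≢⇒≡ᵇ≡false n d (λ n≡d → ℕₚ.<⇒≢ d<n (sym n≡d)))))
                       (+-identityʳ (G d))
... | inj₂ refl = trans (cong₂ _+_ (Σ<-δ-out {n} G ℕₚ.≤-refl) (cong (if_then G n else 0ℚ) (≡ᵇ-refl n)))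
                        (+-identityˡ (G n))

if-*ˡ : ∀ (b : Bool) (a c : ℚ) → a * (if b then c else 0ℚ) ≡ (if b then a * c else 0ℚ)
if-*ˡ true  a c = refl
if-*ˡ false a c = *-zeroʳ a

if-*ʳ : ∀ (b : Bool) (c a : ℚ) → (if b then c else 0ℚ) * a ≡ (if b then c * a else 0ℚ)
if-*ʳ true  c a = refl
if-*ʳ false c a = *-zeroˡ a

length-bernList : ∀ n → length (bernList n) ≡ n
length-bernList zero    = refl
length-bernList (suc n) =
  trans (length-++ (bernList n)) (trans (ℕₚ.+-comm (length (bernList n)) 1) (cong suc (length-bernList n)))

nth-++ˡ : ∀ (xs ys : List ℚ) {k} → k < length xs → nth (xs ++ ys) k ≡ nth xs k
nth-++ˡ (x ∷ xs) ys {zero}  _         = refl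
nth-++ˡ (x ∷ xs) ys {suc k} (s≤s k<n) = nth-++ˡ xs ys k<n

nth-++-length : ∀ (xs : List ℚ) y → nth (xs ++ [ y ]) (length xs) ≡ y
nth-++-length []       y = refl
nth-++-length (x ∷ xs) y = nth-++-length xs y

nth-bernList : ∀ {n k} → k < n → nth (bernList n) k ≡ bernNum k
nth-bernList {suc n} {k} k<1+n with ℕₚ.m≤n⇒m<n∨m≡n (ℕₚ.≤-pred k<1+n)
... | inj₁ k<n = trans (nth-++ˡ (bernList n) _ (subst (k <_) (sym (length-bernList n)) k<n)) (nth-bernList k<n)
... | inj₂ refl = refl

bernNum-suc : ∀ n → bernNum (suc n) ≡ nextBern (suc n) (bernList (suc n))
bernNum-suc n = subst (λ k → nth (bernList (suc n) ++ [ next ]) k ≡ next)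
                      (length-bernList (suc n)) (nth-++-length (bernList (suc n)) next)
  where next = nextBern (suc n) (bernList (suc n))

bernNum-recurrence : ∀ N → Σ< N (λ k → binom N k * bernNum k) ≡ (if N ≡ᵇ 1 then 1ℚ else 0ℚ)
bernNum-recurrence zero          = refl
bernNum-recurrence (suc zero)    = refl
bernNum-recurrence (suc (suc n)) = begin
  S + binom N (suc n) * bernNum (suc n)
    ≡⟨ cong₂ (λ c b → S + c * b) (binom-1+n-n (suc n)) (trans (bernNum-suc n) (cong (λ z → - (u * z)) earlier)) ⟩
  S + ℕ→ℚ N * (- (u * S))
    ≡⟨ solve 3 (λ s d v → s :+ d :* (:- (v :* s)) := s :- d :* v :* s) refl S (ℕ→ℚ N) u ⟩
  S - ℕ→ℚ N * u * S       ≡⟨ cong (λ z → S - z * S) (ℕ→ℚ-*-1/ (suc n)) ⟩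
  S - 1ℚ * S              ≡⟨ solve 1 (λ s → s :- con 1ℚ :* s := con 0ℚ) refl S ⟩
  0ℚ                      ∎
  where
  open ≡-Reasoning
  N = suc (suc n)
  S = Σ< (suc n) (λ k → binom N k * bernNum k)
  u = ℤ.+ 1 /ℚ N
  earlier : Σ< (suc n) (λ k → binom N k * nth (bernList (suc n)) k) ≡ S
  earlier = Σ<-cong< (suc n) (λ k k<1+n → cong (binom N k *_) (nth-bernList k<1+n))

Σ<-binom-bernNum : ∀ {d n} → d ≤ n → Σ< (suc n) (λ k → binom d k * bernNum k) ≡ (if d ≡ᵇ 1 then 1ℚ else 0ℚ) + bernNum d
Σ<-binom-bernNum {d} {n} d≤n = begin
  Σ< (suc n) f            ≡⟨ Σ<-vanishing-tail f (s≤s d≤n) (λ k d<k → trans (cong (_* bernNum k) (binom-vanish d<k)) (*-zeroˡ (bernNum k))) ⟩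
  Σ< d f + binom d d * bernNum d
    ≡⟨ cong₂ _+_ (bernNum-recurrence d) (trans (cong (_* bernNum d) (binom-n-n d)) (*-identityˡ (bernNum d))) ⟩
  (if d ≡ᵇ 1 then 1ℚ else 0ℚ) + bernNum d ∎
  where
  open ≡-Reasoning
  f : ℕ → ℚ
  f k = binom d k * bernNum k

B-padded : ∀ {i N} x → i < N → B i x ≡ Σ< N (λ k → binom i k * bernNum k * x ^ℚ (i ∸ k))
B-padded {i} x i<N = sym (Σ<-vanishing-tail _ i<N (λ k i<k →
  trans (cong (λ c → c * bernNum k * x ^ℚ (i ∸ k)) (binom-vanish i<k))
        (trans (cong (_* x ^ℚ (i ∸ k)) (*-zeroˡ (bernNum k))) (*-zeroˡ (x ^ℚ (i ∸ k))))))

B-reversed : ∀ n x → B n x ≡ Σ< (suc n) (λ s → binom n s * x ^ℚ s * bernNum (n ∸ s))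
B-reversed n x = trans (Σ<-reverse n _) (Σ<-cong< (suc n) (λ s s<1+n →
  let s≤n = ℕₚ.≤-pred s<1+n in
  trans (cong₂ (λ c e → c * bernNum (n ∸ s) * x ^ℚ e) (sym (binom-sym s≤n)) (ℕₚ.m∸[m∸n]≡n s≤n))
        (solve 3 (λ a b c → a :* b :* c := a :* c :* b) refl (binom n s) (bernNum (n ∸ s)) (x ^ℚ s))))

binom-subset′ : ∀ n k s → binom n (k ℕ.+ s) * binom (k ℕ.+ s) k ≡ binom n s * binom (n ∸ s) k
binom-subset′ n k s = begin
  binom n (k ℕ.+ s) * binom (k ℕ.+ s) k ≡⟨ cong₂ (λ a b → binom n a * binom b k) (ℕₚ.+-comm k s) (ℕₚ.+-comm k s) ⟩
  binom n (s ℕ.+ k) * binom (s ℕ.+ k) k ≡⟨ cong (binom n (s ℕ.+ k) *_) (trans (binom-sym (ℕₚ.m≤n+m k s)) (cong (binom (s ℕ.+ k)) (ℕₚ.m+n∸n≡m s k))) ⟩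
  binom n (s ℕ.+ k) * binom (s ℕ.+ k) s ≡⟨ *-comm (binom n (s ℕ.+ k)) _ ⟩
  binom (s ℕ.+ k) s * binom n (s ℕ.+ k) ≡⟨ sym (binom-subset n s k) ⟩
  binom n s * binom (n ∸ s) k ∎
  where open ≡-Reasoning

Σ<-binom-binom-pow : ∀ n x {k} → k < suc n →
  Σ< (suc n) (λ i → binom n i * (binom i k * bernNum k * x ^ℚ (i ∸ k)))
  ≡ Σ< (suc n) (λ s → bernNum k * (binom n s * binom (n ∸ s) k * x ^ℚ s))
Σ<-binom-binom-pow n x {k} k<1+n = begin
  Σ< (suc n) f                     ≡⟨ Σ<-vanishing-head f (ℕₚ.<⇒≤ k<1+n) head≗0 ⟩
  Σ< (suc n ∸ k) (λ s → f (k ℕ.+ s)) ≡⟨ sym (Σ<-vanishing-tail (λ s → f (k ℕ.+ s)) (ℕₚ.m∸n≤m (suc n) k) tail≗0) ⟩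
  Σ< (suc n) (λ s → f (k ℕ.+ s))     ≡⟨ Σ<-cong (suc n) term ⟩
  Σ< (suc n) (λ s → bernNum k * (binom n s * binom (n ∸ s) k * x ^ℚ s)) ∎
  where
  open ≡-Reasoning
  f : ℕ → ℚ
  f i = binom n i * (binom i k * bernNum k * x ^ℚ (i ∸ k))
  head≗0 : ∀ i → i < k → f i ≡ 0ℚ
  head≗0 i i<k = trans (cong (λ c → binom n i * (c * bernNum k * x ^ℚ (i ∸ k))) (binom-vanish i<k))
    (solve 3 (λ a b y → a :* (con 0ℚ :* b :* y) := con 0ℚ) refl (binom n i) (bernNum k) (x ^ℚ (i ∸ k)))
  tail≗0 : ∀ s → suc n ∸ k ≤ s → f (k ℕ.+ s) ≡ 0ℚ
  tail≗0 s 1+n∸k≤s = trans (cong (_* rest) (binom-vanish n<k+s)) (*-zeroˡ rest)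
    where
    rest = binom (k ℕ.+ s) k * bernNum k * x ^ℚ (k ℕ.+ s ∸ k)
    n<k+s : n < k ℕ.+ s
    n<k+s = subst (_≤ k ℕ.+ s) (ℕₚ.m+[n∸m]≡n (ℕₚ.<⇒≤ k<1+n)) (ℕₚ.+-monoʳ-≤ k 1+n∸k≤s)
  term : ∀ s → f (k ℕ.+ s) ≡ bernNum k * (binom n s * binom (n ∸ s) k * x ^ℚ s)
  term s = begin
    binom n (k ℕ.+ s) * (binom (k ℕ.+ s) k * bernNum k * x ^ℚ (k ℕ.+ s ∸ k))
      ≡⟨ cong (λ e → binom n (k ℕ.+ s) * (binom (k ℕ.+ s) k * bernNum k * x ^ℚ e)) (ℕₚ.m+n∸m≡n k s) ⟩
    binom n (k ℕ.+ s) * (binom (k ℕ.+ s) k * bernNum k * x ^ℚ s)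
      ≡⟨ solve 4 (λ a b c d → a :* (b :* c :* d) := c :* (a :* b :* d)) refl
           (binom n (k ℕ.+ s)) (binom (k ℕ.+ s) k) (bernNum k) (x ^ℚ s) ⟩
    bernNum k * (binom n (k ℕ.+ s) * binom (k ℕ.+ s) k * x ^ℚ s)
      ≡⟨ cong (λ c → bernNum k * (c * x ^ℚ s)) (binom-subset′ n k s) ⟩
    bernNum k * (binom n s * binom (n ∸ s) k * x ^ℚ s) ∎

1+m∸s≡ᵇ1 : ∀ m s → s ≤ suc m → (suc m ∸ s ≡ᵇ 1) ≡ (s ≡ᵇ m)
1+m∸s≡ᵇ1 zero    zero          _         = refl
1+m∸s≡ᵇ1 (suc m) zero          _         = refl
1+m∸s≡ᵇ1 zero    (suc zero)    _         = refl
1+m∸s≡ᵇ1 zero    (suc (suc s)) (s≤s ())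
1+m∸s≡ᵇ1 (suc m) (suc s)       (s≤s s≤m) = 1+m∸s≡ᵇ1 m s s≤m

Σ<-binom-pow-δ : ∀ n x → Σ< (suc n) (λ s → binom n s * x ^ℚ s * (if n ∸ s ≡ᵇ 1 then 1ℚ else 0ℚ)) ≡ ℕ→ℚ n * x ^ℚ (n ∸ 1)
Σ<-binom-pow-δ zero    x = refl
Σ<-binom-pow-δ (suc m) x = begin
  Σ< (suc (suc m)) (λ s → binom (suc m) s * x ^ℚ s * (if suc m ∸ s ≡ᵇ 1 then 1ℚ else 0ℚ))
    ≡⟨ Σ<-cong< (suc (suc m)) (λ s s<2+m →
         trans (cong (λ b → binom (suc m) s * x ^ℚ s * (if b then 1ℚ else 0ℚ)) (1+m∸s≡ᵇ1 m s (ℕₚ.≤-pred s<2+m)))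
               (indicator (s ≡ᵇ m))) ⟩
  Σ< (suc (suc m)) (λ s → if s ≡ᵇ m then binom (suc m) s * x ^ℚ s else 0ℚ)
    ≡⟨ Σ<-δ {d = m} (λ s → binom (suc m) s * x ^ℚ s) (ℕₚ.m<n⇒m<1+n ℕₚ.≤-refl) ⟩
  binom (suc m) m * x ^ℚ m                 ≡⟨ cong (_* x ^ℚ m) (binom-1+n-n m) ⟩
  ℕ→ℚ (suc m) * x ^ℚ m                     ∎
  where
  open ≡-Reasoning
  indicator : ∀ {a} (b : Bool) → a * (if b then 1ℚ else 0ℚ) ≡ (if b then a else 0ℚ)
  indicator {a} true  = *-identityʳ a
  indicator {a} false = *-zeroʳ a

-- The left-hand side is B_n(x+1).
B-translate : ∀ n x → Σ< (suc n) (λ i → binom n i * B i x) ≡ B n x + ℕ→ℚ n * x ^ℚ (n ∸ 1)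
B-translate n x = begin
  Σ< N (λ i → binom n i * B i x)
    ≡⟨ Σ<-cong< N (λ i i<N → trans (cong (binom n i *_) (B-padded x i<N)) (*-distribˡ-Σ< N (binom n i) _)) ⟩
  Σ< N (λ i → Σ< N (λ k → binom n i * (binom i k * bernNum k * x ^ℚ (i ∸ k))))
    ≡⟨ Σ<-comm N N (λ i k → binom n i * (binom i k * bernNum k * x ^ℚ (i ∸ k))) ⟩
  Σ< N (λ k → Σ< N (λ i → binom n i * (binom i k * bernNum k * x ^ℚ (i ∸ k))))
    ≡⟨ Σ<-cong< N (λ k k<N → Σ<-binom-binom-pow n x k<N) ⟩
  Σ< N (λ k → Σ< N (λ s → bernNum k * (binom n s * binom (n ∸ s) k * x ^ℚ s)))
    ≡⟨ Σ<-comm N N (λ k s → bernNum k * (binom n s * binom (n ∸ s) k * x ^ℚ s)) ⟩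
  Σ< N (λ s → Σ< N (λ k → bernNum k * (binom n s * binom (n ∸ s) k * x ^ℚ s)))
    ≡⟨ Σ<-cong N (λ s → trans (Σ<-cong N (λ k → solve 4 (λ b c d y → b :* (c :* d :* y) := c :* y :* (d :* b)) refl
                                  (bernNum k) (binom n s) (binom (n ∸ s) k) (x ^ℚ s)))
                              (sym (*-distribˡ-Σ< N (binom n s * x ^ℚ s) (λ k → binom (n ∸ s) k * bernNum k)))) ⟩
  Σ< N (λ s → binom n s * x ^ℚ s * Σ< N (λ k → binom (n ∸ s) k * bernNum k))
    ≡⟨ Σ<-cong N (λ s → trans (cong (binom n s * x ^ℚ s *_) (Σ<-binom-bernNum (ℕₚ.m∸n≤m n s)))
         (solve 3 (λ a d b → a :* (d :+ b) := a :* b :+ a :* d) refl (binom n s * x ^ℚ s) (δ s) (bernNum (n ∸ s)))) ⟩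
  Σ< N (λ s → binom n s * x ^ℚ s * bernNum (n ∸ s) + binom n s * x ^ℚ s * δ s)
    ≡⟨ Σ<-distrib-+ N _ _ ⟩
  Σ< N (λ s → binom n s * x ^ℚ s * bernNum (n ∸ s)) + Σ< N (λ s → binom n s * x ^ℚ s * δ s)
    ≡⟨ cong₂ _+_ (sym (B-reversed n x)) (Σ<-binom-pow-δ n x) ⟩
  B n x + ℕ→ℚ n * x ^ℚ (n ∸ 1) ∎
  where
  open ≡-Reasoning
  N = suc n
  δ : ℕ → ℚ
  δ s = if n ∸ s ≡ᵇ 1 then 1ℚ else 0ℚ

B-translate-padded : ∀ {d M} x → d < M → Σ< M (λ i → binom d i * B i x) ≡ B d x + ℕ→ℚ d * x ^ℚ (d ∸ 1)
B-translate-padded {d} x d<M = trans (Σ<-vanishing-tail _ d<M (λ i d<i → trans (cong (_* B i x) (binom-vanish d<i)) (*-zeroˡ (B i x))))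
                                     (B-translate d x)

sgn-suc : ∀ n → sgn (suc n) ≡ - sgn n
sgn-suc zero          = refl
sgn-suc (suc zero)    = refl
sgn-suc (suc (suc n)) = sgn-suc n

Δbinom : ℕ → ℕ → ℕ → ℚ
Δbinom m s p = Σ< (suc m) (λ j → sgn (j ℕ.+ m) * binom m j * binom (j ℕ.+ s) p)

-- C(s, p ∸ m) when m ≤ p, and 0 otherwise.
shiftedBinom : ℕ → ℕ → ℕ → ℚ
shiftedBinom zero    s p       = binom s p
shiftedBinom (suc m) s zero    = 0ℚ
shiftedBinom (suc m) s (suc p) = shiftedBinom m s p

Δbinom-suc : ∀ m s p → Δbinom (suc m) s p ≡ Δbinom m (suc s) p - Δbinom m s p
Δbinom-suc m s p = begin
  Δbinom (suc m) s p                          ≡⟨ Σ<-suc-head (suc m) g ⟩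
  g 0 + Σ< (suc m) (λ i → g (suc i))          ≡⟨ cong₂ _+_ g0 (trans (Σ<-cong (suc m) g-suc) (Σ<-distrib-+ (suc m) _ t)) ⟩
  - (sgn m * binom s p) + (Δbinom m (suc s) p + (Σ< m t + t m))
    ≡⟨ cong (λ z → - (sgn m * binom s p) + (Δbinom m (suc s) p + (Σ< m t + z))) t-last ⟩
  - (sgn m * binom s p) + (Δbinom m (suc s) p + (Σ< m t + 0ℚ))
    ≡⟨ solve 3 (λ c d e → :- c :+ (d :+ (e :+ con 0ℚ)) := d :- (c :- e)) refl (sgn m * binom s p) (Δbinom m (suc s) p) (Σ< m t) ⟩
  Δbinom m (suc s) p - (sgn m * binom s p - Σ< m t) ≡⟨ cong (λ z → Δbinom m (suc s) p - z) (sym Δbinom-head) ⟩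
  Δbinom m (suc s) p - Δbinom m s p               ∎
  where
  open ≡-Reasoning
  g : ℕ → ℚ
  g j = sgn (j ℕ.+ suc m) * binom (suc m) j * binom (j ℕ.+ s) p
  t : ℕ → ℚ
  t i = sgn (i ℕ.+ m) * binom m (suc i) * binom (suc i ℕ.+ s) p
  g0 : g 0 ≡ - (sgn m * binom s p)
  g0 = trans (cong (λ z → z * 1ℚ * binom s p) (sgn-suc m))
             (solve 2 (λ a b → :- a :* con 1ℚ :* b := :- (a :* b)) refl (sgn m) (binom s p))
  g-suc : ∀ i → g (suc i) ≡ sgn (i ℕ.+ m) * binom m i * binom (i ℕ.+ suc s) p + t i
  g-suc i = begin
    sgn (suc (i ℕ.+ suc m)) * binom (suc m) (suc i) * binom (suc i ℕ.+ s) p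
      ≡⟨ cong₂ (λ e c → sgn (suc e) * c * binom (suc i ℕ.+ s) p) (ℕₚ.+-suc i m) (binom-pascal m i) ⟩
    sgn (i ℕ.+ m) * (binom m i + binom m (suc i)) * binom (suc i ℕ.+ s) p
      ≡⟨ solve 4 (λ a b c d → a :* (b :+ c) :* d := a :* b :* d :+ a :* c :* d) refl
           (sgn (i ℕ.+ m)) (binom m i) (binom m (suc i)) (binom (suc i ℕ.+ s) p) ⟩
    sgn (i ℕ.+ m) * binom m i * binom (suc i ℕ.+ s) p + t i
      ≡⟨ cong (λ z → sgn (i ℕ.+ m) * binom m i * binom z p + t i) (sym (ℕₚ.+-suc i s)) ⟩
    sgn (i ℕ.+ m) * binom m i * binom (i ℕ.+ suc s) p + t i ∎
  t-last : t m ≡ 0ℚ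
  t-last = trans (cong (λ c → sgn (m ℕ.+ m) * c * binom (suc m ℕ.+ s) p) (binom-vanish (ℕₚ.n<1+n m)))
                 (solve 2 (λ a b → a :* con 0ℚ :* b := con 0ℚ) refl (sgn (m ℕ.+ m)) (binom (suc m ℕ.+ s) p))
  Δbinom-head : Δbinom m s p ≡ sgn m * binom s p - Σ< m t
  Δbinom-head = begin
    Δbinom m s p       ≡⟨ Σ<-suc-head m _ ⟩
    sgn m * 1ℚ * binom s p + Σ< m (λ i → sgn (suc i ℕ.+ m) * binom m (suc i) * binom (suc i ℕ.+ s) p)
      ≡⟨ cong₂ _+_ (cong (_* binom s p) (*-identityʳ (sgn m)))
           (Σ<-cong m (λ i → trans (cong (λ z → z * binom m (suc i) * binom (suc i ℕ.+ s) p) (sgn-suc (i ℕ.+ m)))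
             (solve 3 (λ a b c → :- a :* b :* c := :- (a :* b :* c)) refl (sgn (i ℕ.+ m)) (binom m (suc i)) (binom (suc i ℕ.+ s) p)))) ⟩
    sgn m * binom s p + Σ< m (λ i → - t i) ≡⟨ cong (sgn m * binom s p +_) (sym (neg-distrib-Σ< m t)) ⟩
    sgn m * binom s p - Σ< m t ∎

shiftedBinom-suc : ∀ m s p → shiftedBinom m (suc s) p - shiftedBinom m s p ≡ shiftedBinom (suc m) s p
shiftedBinom-suc zero    s zero    = +-inverseʳ 1ℚ
shiftedBinom-suc zero    s (suc p) = trans (cong (_- binom s (suc p)) (binom-pascal s p))
  (solve 2 (λ a b → a :+ b :- b := a) refl (binom s p) (binom s (suc p)))
shiftedBinom-suc (suc m) s zero    = +-inverseʳ 0ℚ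
shiftedBinom-suc (suc m) s (suc p) = shiftedBinom-suc m s p

Δbinom≡shiftedBinom : ∀ m s p → Δbinom m s p ≡ shiftedBinom m s p
Δbinom≡shiftedBinom zero    s p = trans (+-identityˡ _) (*-identityˡ (binom s p))
Δbinom≡shiftedBinom (suc m) s p = begin
  Δbinom (suc m) s p                               ≡⟨ Δbinom-suc m s p ⟩
  Δbinom m (suc s) p - Δbinom m s p                 ≡⟨ cong₂ _-_ (Δbinom≡shiftedBinom m (suc s) p) (Δbinom≡shiftedBinom m s p) ⟩
  shiftedBinom m (suc s) p - shiftedBinom m s p     ≡⟨ shiftedBinom-suc m s p ⟩
  shiftedBinom (suc m) s p                         ∎
  where open ≡-Reasoning

shiftedBinom-δ : ∀ m s P → shiftedBinom m s P ≡ Σ< (suc s) (λ q → if m ℕ.+ q ≡ᵇ P then binom s q else 0ℚ)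
shiftedBinom-δ zero s P with P ℕₚ.<? suc s
... | yes P<1+s = sym (Σ<-δ (binom s) P<1+s)
... | no  P≮1+s = trans (binom-vanish (ℕₚ.≰⇒> (λ P≤s → P≮1+s (s≤s P≤s)))) (sym (Σ<-δ-out (binom s) (ℕₚ.≮⇒≥ P≮1+s)))
shiftedBinom-δ (suc m) s zero    = sym (Σ<-0 (suc s) (λ _ _ → refl))
shiftedBinom-δ (suc m) s (suc P) = shiftedBinom-δ m s P

isOdd-double : ∀ m → isOdd (m ℕ.+ m) ≡ false
isOdd-double zero    = refl
isOdd-double (suc m) = trans (cong (λ n → isOdd (suc n)) (ℕₚ.+-suc m m)) (isOdd-double m)

½[w-sgn*w] : ∀ n w → ½ * (w - sgn n * w) ≡ (if isOdd n then w else 0ℚ)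
½[w-sgn*w] n w with isOdd n
... | true  = solve 1 (λ w → con ½ :* (w :- con (- 1ℚ) :* w) := w) refl w
... | false = solve 1 (λ w → con ½ :* (w :- con 1ℚ :* w) := con 0ℚ) refl w

½[Σ-Σsgn]≡Σodd : ∀ n m (w : ℕ → ℚ) →
  ½ * (Σ< n w - Σ< n (λ j → sgn (j ℕ.+ m) * w j)) ≡ Σ< n (λ j → if isOdd (j ℕ.+ m) then w j else 0ℚ)
½[Σ-Σsgn]≡Σodd zero    m w = refl
½[Σ-Σsgn]≡Σodd (suc n) m w = begin
  ½ * ((Σ< n w + w n) - (Σ< n (λ j → sgn (j ℕ.+ m) * w j) + sgn (n ℕ.+ m) * w n))
    ≡⟨ solve 5 (λ h a b c d → h :* ((a :+ c) :- (b :+ d)) := h :* (a :- b) :+ h :* (c :- d)) refl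
         ½ (Σ< n w) (Σ< n (λ j → sgn (j ℕ.+ m) * w j)) (w n) (sgn (n ℕ.+ m) * w n) ⟩
  ½ * (Σ< n w - Σ< n (λ j → sgn (j ℕ.+ m) * w j)) + ½ * (w n - sgn (n ℕ.+ m) * w n)
    ≡⟨ cong₂ _+_ (½[Σ-Σsgn]≡Σodd n m w) (½[w-sgn*w] (n ℕ.+ m) (w n)) ⟩
  Σ< (suc n) (λ j → if isOdd (j ℕ.+ m) then w j else 0ℚ) ∎
  where open ≡-Reasoning

module BernoulliOddSum (m r : ℕ) (x : ℚ) where

  w : ℕ → ℚ
  w q = binom m q * binom (q ℕ.+ m) r * B (q ℕ.+ m ∸ r) x

  a : ℕ → ℚ
  a j = sgn (j ℕ.+ m) * binom m j * binom (j ℕ.+ m) r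

  deg : ℕ → ℕ
  deg j = j ℕ.+ m ∸ r

  M : ℕ
  M = suc (m ℕ.+ m)

  deg<M : ∀ {j} → j ≤ m → deg j < M
  deg<M j≤m = s≤s (ℕₚ.≤-trans (ℕₚ.m∸n≤m _ r) (ℕₚ.+-monoˡ-≤ m j≤m))

  translate : ℕ → ℚ
  translate j = Σ< M (λ i → binom (deg j) i * B i x)

  rhs-term : ∀ {j} → j ≤ m →
    sgn (j ℕ.+ m) * binom m j * binom (j ℕ.+ m ∸ 1) r * ℕ→ℚ (j ℕ.+ m) * x ^ℚ (j ℕ.+ m ∸ 1 ∸ r)
    ≡ a j * (translate j - B (deg j) x)
  rhs-term {j} j≤m = begin
    sgn n * binom m j * binom (n ∸ 1) r * ℕ→ℚ n * x ^ℚ (n ∸ 1 ∸ r)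
      ≡⟨ cong (λ e → sgn n * binom m j * binom (n ∸ 1) r * ℕ→ℚ n * x ^ℚ e) (m∸n∸o≡m∸o∸n n 1 r) ⟩
    sgn n * binom m j * binom (n ∸ 1) r * ℕ→ℚ n * x ^ℚ (deg j ∸ 1)
      ≡⟨ solve 5 (λ s b c e y → s :* b :* c :* e :* y := s :* b :* (c :* e) :* y) refl
           (sgn n) (binom m j) (binom (n ∸ 1) r) (ℕ→ℚ n) (x ^ℚ (deg j ∸ 1)) ⟩
    sgn n * binom m j * (binom (n ∸ 1) r * ℕ→ℚ n) * x ^ℚ (deg j ∸ 1)
      ≡⟨ cong (λ c → sgn n * binom m j * c * x ^ℚ (deg j ∸ 1)) (binom-absorb n r) ⟩
    sgn n * binom m j * (binom n r * ℕ→ℚ (deg j)) * x ^ℚ (deg j ∸ 1)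
      ≡⟨ solve 5 (λ s b c e y → s :* b :* (c :* e) :* y := s :* b :* c :* (e :* y)) refl
           (sgn n) (binom m j) (binom n r) (ℕ→ℚ (deg j)) (x ^ℚ (deg j ∸ 1)) ⟩
    a j * (ℕ→ℚ (deg j) * x ^ℚ (deg j ∸ 1))
      ≡⟨ cong (a j *_) (trans (solve 2 (λ b d → d := b :+ d :- b) refl (B (deg j) x) (ℕ→ℚ (deg j) * x ^ℚ (deg j ∸ 1)))
                              (cong (_- B (deg j) x) (sym (B-translate-padded x (deg<M j≤m))))) ⟩
    a j * (translate j - B (deg j) x) ∎
    where
    open ≡-Reasoning
    n = j ℕ.+ m

  Σ-a-binom-deg : ∀ i → Σ< (suc m) (λ j → a j * (binom (deg j) i * B i x))
                      ≡ Σ< (suc m) (λ q → if m ℕ.+ q ≡ᵇ r ℕ.+ i then binom m q * (binom (r ℕ.+ i) r * B i x) else 0ℚ)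
  Σ-a-binom-deg i = begin
    Σ< (suc m) (λ j → a j * (binom (deg j) i * B i x))
      ≡⟨ Σ<-cong (suc m) (λ j → trans
           (solve 5 (λ s b c e y → s :* b :* c :* (e :* y) := s :* b :* (c :* e) :* y) refl
              (sgn (j ℕ.+ m)) (binom m j) (binom (j ℕ.+ m) r) (binom (deg j) i) (B i x))
           (trans (cong (λ c → sgn (j ℕ.+ m) * binom m j * c * B i x) (binom-subset (j ℕ.+ m) r i))
             (solve 5 (λ s b c e y → s :* b :* (c :* e) :* y := s :* b :* e :* (c :* y)) refl
              (sgn (j ℕ.+ m)) (binom m j) (binom (r ℕ.+ i) r) (binom (j ℕ.+ m) (r ℕ.+ i)) (B i x)))) ⟩
    Σ< (suc m) (λ j → sgn (j ℕ.+ m) * binom m j * binom (j ℕ.+ m) (r ℕ.+ i) * c)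
      ≡⟨ sym (*-distribʳ-Σ< (suc m) c _) ⟩
    Δbinom m m (r ℕ.+ i) * c
      ≡⟨ cong (_* c) (trans (Δbinom≡shiftedBinom m m (r ℕ.+ i)) (shiftedBinom-δ m m (r ℕ.+ i))) ⟩
    Σ< (suc m) (λ q → if m ℕ.+ q ≡ᵇ r ℕ.+ i then binom m q else 0ℚ) * c
      ≡⟨ *-distribʳ-Σ< (suc m) c _ ⟩
    Σ< (suc m) (λ q → (if m ℕ.+ q ≡ᵇ r ℕ.+ i then binom m q else 0ℚ) * c)
      ≡⟨ Σ<-cong (suc m) (λ q → if-*ʳ (m ℕ.+ q ≡ᵇ r ℕ.+ i) (binom m q) c) ⟩
    Σ< (suc m) (λ q → if m ℕ.+ q ≡ᵇ r ℕ.+ i then binom m q * c else 0ℚ) ∎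
    where
    open ≡-Reasoning
    c = binom (r ℕ.+ i) r * B i x

  δ-term : ℕ → ℕ → ℚ
  δ-term q i = if m ℕ.+ q ≡ᵇ r ℕ.+ i then binom m q * (binom (r ℕ.+ i) r * B i x) else 0ℚ

  Σ-δ-term-≥ : ∀ {q} → q ≤ m → r ≤ m ℕ.+ q → Σ< M (δ-term q) ≡ w q
  Σ-δ-term-≥ {q} q≤m r≤m+q = begin
    Σ< M (δ-term q)
      ≡⟨ Σ<-cong M (λ i → cong (if_then F i else 0ℚ)
           (trans (cong (_≡ᵇ r ℕ.+ i) (sym r+d≡m+q)) (trans (≡ᵇ-cancelˡ-+ r d i) (≡ᵇ-sym d i)))) ⟩
    Σ< M (λ i → if i ≡ᵇ d then F i else 0ℚ) ≡⟨ Σ<-δ F d<M ⟩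
    binom m q * (binom (r ℕ.+ d) r * B d x)
      ≡⟨ cong₂ (λ n e → binom m q * (binom n r * B e x)) (trans r+d≡m+q (ℕₚ.+-comm m q)) (cong (_∸ r) (ℕₚ.+-comm m q)) ⟩
    binom m q * (binom (q ℕ.+ m) r * B (q ℕ.+ m ∸ r) x)
      ≡⟨ sym (*-assoc (binom m q) (binom (q ℕ.+ m) r) (B (q ℕ.+ m ∸ r) x)) ⟩
    w q ∎
    where
    open ≡-Reasoning
    d = m ℕ.+ q ∸ r
    r+d≡m+q : r ℕ.+ d ≡ m ℕ.+ q
    r+d≡m+q = ℕₚ.m+[n∸m]≡n r≤m+q
    d<M : d < M
    d<M = s≤s (ℕₚ.≤-trans (ℕₚ.m∸n≤m (m ℕ.+ q) r) (ℕₚ.+-monoʳ-≤ m q≤m))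
    F : ℕ → ℚ
    F i = binom m q * (binom (r ℕ.+ i) r * B i x)

  Σ-δ-term-< : ∀ {q} → m ℕ.+ q < r → Σ< M (δ-term q) ≡ w q
  Σ-δ-term-< {q} m+q<r = begin
    Σ< M (δ-term q)
      ≡⟨ Σ<-0 M (λ i _ → cong (if_then binom m q * (binom (r ℕ.+ i) r * B i x) else 0ℚ)
           (≢⇒≡ᵇ≡false (m ℕ.+ q) (r ℕ.+ i) (λ m+q≡r+i → ℕₚ.<⇒≱ m+q<r (subst (r ≤_) (sym m+q≡r+i) (ℕₚ.m≤m+n r i))))) ⟩
    0ℚ
      ≡⟨ sym (solve 2 (λ c b → c :* con 0ℚ :* b := con 0ℚ) refl (binom m q) (B (q ℕ.+ m ∸ r) x)) ⟩
    binom m q * 0ℚ * B (q ℕ.+ m ∸ r) x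
      ≡⟨ cong (λ c → binom m q * c * B (q ℕ.+ m ∸ r) x) (sym (binom-vanish (subst (_< r) (ℕₚ.+-comm m q) m+q<r))) ⟩
    w q ∎
    where open ≡-Reasoning

  Σ-δ-term : ∀ {q} → q ≤ m → Σ< M (δ-term q) ≡ w q
  Σ-δ-term q≤m = [ Σ-δ-term-≥ q≤m , Σ-δ-term-< ]′ (ℕₚ.≤-<-connex r _)

  Σ-a-translate : Σ< (suc m) (λ j → a j * translate j) ≡ Σ< (suc m) w
  Σ-a-translate = begin
    Σ< (suc m) (λ j → a j * translate j)
      ≡⟨ Σ<-cong (suc m) (λ j → *-distribˡ-Σ< M (a j) _) ⟩
    Σ< (suc m) (λ j → Σ< M (λ i → a j * (binom (deg j) i * B i x)))
      ≡⟨ Σ<-comm (suc m) M (λ j i → a j * (binom (deg j) i * B i x)) ⟩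
    Σ< M (λ i → Σ< (suc m) (λ j → a j * (binom (deg j) i * B i x)))
      ≡⟨ Σ<-cong M Σ-a-binom-deg ⟩
    Σ< M (λ i → Σ< (suc m) (λ q → δ-term q i))
      ≡⟨ Σ<-comm M (suc m) (λ i q → δ-term q i) ⟩
    Σ< (suc m) (λ q → Σ< M (δ-term q))
      ≡⟨ Σ<-cong< (suc m) (λ q q<1+m → Σ-δ-term (ℕₚ.≤-pred q<1+m)) ⟩
    Σ< (suc m) w ∎
    where open ≡-Reasoning

  bernoulli-odd-sum :
    Σ< m (λ k → if isOdd (k ℕ.+ m) then w k else 0ℚ)
    ≡ ½ * Σ< (suc m) (λ j → sgn (j ℕ.+ m) * binom m j * binom (j ℕ.+ m ∸ 1) r * ℕ→ℚ (j ℕ.+ m) * x ^ℚ (j ℕ.+ m ∸ 1 ∸ r))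
  bernoulli-odd-sum = sym (begin
    ½ * Σ< (suc m) (λ j → sgn (j ℕ.+ m) * binom m j * binom (j ℕ.+ m ∸ 1) r * ℕ→ℚ (j ℕ.+ m) * x ^ℚ (j ℕ.+ m ∸ 1 ∸ r))
      ≡⟨ cong (½ *_) (Σ<-cong< (suc m) (λ j j<1+m → trans (rhs-term (ℕₚ.≤-pred j<1+m))
           (solve 3 (λ u s b → u :* (s :- b) := u :* s :+ (:- (u :* b))) refl (a j) (translate j) (B (deg j) x)))) ⟩
    ½ * Σ< (suc m) (λ j → a j * translate j + - (a j * B (deg j) x))
      ≡⟨ cong (½ *_) (trans (Σ<-distrib-+ (suc m) (λ j → a j * translate j) (λ j → - (a j * B (deg j) x)))
                            (cong (Σ< (suc m) (λ j → a j * translate j) +_) (sym (neg-distrib-Σ< (suc m) (λ j → a j * B (deg j) x))))) ⟩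
    ½ * (Σ< (suc m) (λ j → a j * translate j) - Σ< (suc m) (λ j → a j * B (deg j) x))
      ≡⟨ cong₂ (λ u v → ½ * (u - v)) Σ-a-translate (Σ<-cong (suc m) (λ j →
           solve 4 (λ s b c y → s :* b :* c :* y := s :* (b :* c :* y)) refl
             (sgn (j ℕ.+ m)) (binom m j) (binom (j ℕ.+ m) r) (B (deg j) x))) ⟩
    ½ * (Σ< (suc m) w - Σ< (suc m) (λ j → sgn (j ℕ.+ m) * w j))
      ≡⟨ ½[Σ-Σsgn]≡Σodd (suc m) m w ⟩
    Σ< m (λ j → if isOdd (j ℕ.+ m) then w j else 0ℚ) + (if isOdd (m ℕ.+ m) then w m else 0ℚ)
      ≡⟨ trans (cong (λ b → odd-part + (if b then w m else 0ℚ)) (isOdd-double m)) (+-identityʳ odd-part) ⟩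
    Σ< m (λ k → if isOdd (k ℕ.+ m) then w k else 0ℚ) ∎)
    where
    open ≡-Reasoning
    odd-part = Σ< m (λ k → if isOdd (k ℕ.+ m) then w k else 0ℚ)

open BernoulliOddSum using (bernoulli-odd-sum)

bernoulli-odd-sum-binom² : ∀ m ν L x →
  Σ< m (λ k → if isOdd (k ℕ.+ m)
                then binom m k * binom (k ℕ.+ m) ν * binom (k ℕ.+ m ∸ ν) L * B (k ℕ.+ m ∸ (ν ℕ.+ L)) x
                else 0ℚ)
  ≡ ½ * Σ< (suc m) (λ j → sgn (j ℕ.+ m) * binom m j * binom (j ℕ.+ m ∸ 1) ν * binom (j ℕ.+ m ∸ 1 ∸ ν) L
                           * ℕ→ℚ (j ℕ.+ m) * x ^ℚ (j ℕ.+ m ∸ 1 ∸ (ν ℕ.+ L)))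
bernoulli-odd-sum-binom² m ν L x = begin
  Σ< m (λ k → if isOdd (k ℕ.+ m) then lhs k else 0ℚ)
    ≡⟨ Σ<-cong m (λ k → trans (cong (λ z → if isOdd (k ℕ.+ m) then z else 0ℚ) (lhs≡c*w k)) (sym (if-*ˡ (isOdd (k ℕ.+ m)) c (w k)))) ⟩
  Σ< m (λ k → c * (if isOdd (k ℕ.+ m) then w k else 0ℚ))
    ≡⟨ sym (*-distribˡ-Σ< m c _) ⟩
  c * Σ< m (λ k → if isOdd (k ℕ.+ m) then w k else 0ℚ)
    ≡⟨ cong (c *_) (bernoulli-odd-sum m r x) ⟩
  c * (½ * Σ< (suc m) G)
    ≡⟨ solve 3 (λ c h s → c :* (h :* s) := h :* (c :* s)) refl c ½ (Σ< (suc m) G) ⟩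
  ½ * (c * Σ< (suc m) G)
    ≡⟨ cong (½ *_) (trans (*-distribˡ-Σ< (suc m) c G) (Σ<-cong (suc m) (λ j → sym (rhs≡c*G j)))) ⟩
  ½ * Σ< (suc m) rhs ∎
  where
  open ≡-Reasoning
  r = ν ℕ.+ L
  c = binom r ν
  w : ℕ → ℚ
  w k = binom m k * binom (k ℕ.+ m) r * B (k ℕ.+ m ∸ r) x
  lhs : ℕ → ℚ
  lhs k = binom m k * binom (k ℕ.+ m) ν * binom (k ℕ.+ m ∸ ν) L * B (k ℕ.+ m ∸ r) x
  G : ℕ → ℚ
  G j = sgn (j ℕ.+ m) * binom m j * binom (j ℕ.+ m ∸ 1) r * ℕ→ℚ (j ℕ.+ m) * x ^ℚ (j ℕ.+ m ∸ 1 ∸ r)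
  rhs : ℕ → ℚ
  rhs j = sgn (j ℕ.+ m) * binom m j * binom (j ℕ.+ m ∸ 1) ν * binom (j ℕ.+ m ∸ 1 ∸ ν) L * ℕ→ℚ (j ℕ.+ m) * x ^ℚ (j ℕ.+ m ∸ 1 ∸ r)
  lhs≡c*w : ∀ k → lhs k ≡ c * w k
  lhs≡c*w k = begin
    lhs k ≡⟨ solve 4 (λ a b e y → a :* b :* e :* y := a :* (b :* e) :* y) refl (binom m k) (binom n ν) (binom (n ∸ ν) L) (B (n ∸ r) x) ⟩
    binom m k * (binom n ν * binom (n ∸ ν) L) * B (n ∸ r) x ≡⟨ cong (λ z → binom m k * z * B (n ∸ r) x) (binom-subset n ν L) ⟩
    binom m k * (c * binom n r) * B (n ∸ r) x ≡⟨ solve 4 (λ a c b y → a :* (c :* b) :* y := c :* (a :* b :* y)) refl (binom m k) c (binom n r) (B (n ∸ r) x) ⟩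
    c * w k ∎
    where n = k ℕ.+ m
  rhs≡c*G : ∀ j → rhs j ≡ c * G j
  rhs≡c*G j = begin
    rhs j ≡⟨ solve 6 (λ s a b e d y → s :* a :* b :* e :* d :* y := s :* a :* (b :* e) :* d :* y) refl
               (sgn (j ℕ.+ m)) (binom m j) (binom n ν) (binom (n ∸ ν) L) (ℕ→ℚ (j ℕ.+ m)) (x ^ℚ (n ∸ r)) ⟩
    sgn (j ℕ.+ m) * binom m j * (binom n ν * binom (n ∸ ν) L) * ℕ→ℚ (j ℕ.+ m) * x ^ℚ (n ∸ r)
      ≡⟨ cong (λ z → sgn (j ℕ.+ m) * binom m j * z * ℕ→ℚ (j ℕ.+ m) * x ^ℚ (n ∸ r)) (binom-subset n ν L) ⟩
    sgn (j ℕ.+ m) * binom m j * (c * binom n r) * ℕ→ℚ (j ℕ.+ m) * x ^ℚ (n ∸ r)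
      ≡⟨ solve 6 (λ s a c b d y → s :* a :* (c :* b) :* d :* y := c :* (s :* a :* b :* d :* y)) refl
           (sgn (j ℕ.+ m)) (binom m j) c (binom n r) (ℕ→ℚ (j ℕ.+ m)) (x ^ℚ (n ∸ r)) ⟩
    c * G j ∎
    where n = j ℕ.+ m ∸ 1

bernoulli-identity-B[k+m-ν-ℓ] : ∀ (m ν ℓ : ℕ) → 1 ≤ m → ∀ (x : ℚ) →
  ΣOdd m 0 (m ∸ 1) (λ k → binom m k * binom (k ℕ.+ m) ν * binom (k ℕ.+ m ∸ ν) ℓ * B (k ℕ.+ m ∸ ν ∸ ℓ) x)
  ≡ ½ * ΣFromTo 0 m (λ j → sgn (j ℕ.+ m) * binom m j * binom (j ℕ.+ m ∸ 1) ν
          * binom (j ℕ.+ m ∸ ν ∸ 1) ℓ * ℕ→ℚ (j ℕ.+ m) * (x ^ℚ (j ℕ.+ m ∸ ν ∸ ℓ ∸ 1)))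
bernoulli-identity-B[k+m-ν-ℓ] m@(suc _) ν ℓ _ x = begin
  Σ< m (λ k → if isOdd (k ℕ.+ m) then binom m k * binom (k ℕ.+ m) ν * binom (k ℕ.+ m ∸ ν) ℓ * B (k ℕ.+ m ∸ ν ∸ ℓ) x else 0ℚ)
    ≡⟨ Σ<-cong m (λ k → cong (λ e → if isOdd (k ℕ.+ m) then binom m k * binom (k ℕ.+ m) ν * binom (k ℕ.+ m ∸ ν) ℓ * B e x else 0ℚ)
                             (ℕₚ.∸-+-assoc (k ℕ.+ m) ν ℓ)) ⟩
  _ ≡⟨ bernoulli-odd-sum-binom² m ν ℓ x ⟩
  ½ * Σ< (suc m) (λ j → sgn (j ℕ.+ m) * binom m j * binom (j ℕ.+ m ∸ 1) ν * binom (j ℕ.+ m ∸ 1 ∸ ν) ℓ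
                         * ℕ→ℚ (j ℕ.+ m) * x ^ℚ (j ℕ.+ m ∸ 1 ∸ (ν ℕ.+ ℓ)))
    ≡⟨ cong (½ *_) (Σ<-cong (suc m) (λ j → cong₂
         (λ n e → sgn (j ℕ.+ m) * binom m j * binom (j ℕ.+ m ∸ 1) ν * binom n ℓ * ℕ→ℚ (j ℕ.+ m) * x ^ℚ e)
         (m∸n∸o≡m∸o∸n (j ℕ.+ m) 1 ν)
         (sym (trans (cong (_∸ 1) (ℕₚ.∸-+-assoc (j ℕ.+ m) ν ℓ)) (m∸n∸o≡m∸o∸n (j ℕ.+ m) (ν ℕ.+ ℓ) 1))))) ⟩
  ½ * Σ< (suc m) (λ j → sgn (j ℕ.+ m) * binom m j * binom (j ℕ.+ m ∸ 1) ν
          * binom (j ℕ.+ m ∸ ν ∸ 1) ℓ * ℕ→ℚ (j ℕ.+ m) * (x ^ℚ (j ℕ.+ m ∸ ν ∸ ℓ ∸ 1))) ∎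
  where open ≡-Reasoning

bernoulli-identity-B[k+1] : ∀ (m ν : ℕ) → 1 ≤ m → ν ≤ m ∸ 1 → ∀ (x : ℚ) →
  ΣOdd m 0 (m ∸ 1) (λ k → binom m k * binom (k ℕ.+ m) ν * binom (k ℕ.+ m ∸ ν) (m ∸ ν ∸ 1) * B (suc k) x)
  ≡ ½ * ΣFromTo 0 m (λ j → sgn (j ℕ.+ m) * binom m j * binom (j ℕ.+ m ∸ 1) ν
          * binom (j ℕ.+ m ∸ ν ∸ 1) (m ∸ ν ∸ 1) * ℕ→ℚ (j ℕ.+ m) * (x ^ℚ j))
bernoulli-identity-B[k+1] m@(suc m') ν _ ν≤m' x = begin
  Σ< m (λ k → if isOdd (k ℕ.+ m) then binom m k * binom (k ℕ.+ m) ν * binom (k ℕ.+ m ∸ ν) L * B (suc k) x else 0ℚ)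
    ≡⟨ Σ<-cong m (λ k → cong (λ e → if isOdd (k ℕ.+ m) then binom m k * binom (k ℕ.+ m) ν * binom (k ℕ.+ m ∸ ν) L * B e x else 0ℚ)
                             (sym (B-index k))) ⟩
  _ ≡⟨ bernoulli-odd-sum-binom² m ν L x ⟩
  ½ * Σ< (suc m) (λ j → sgn (j ℕ.+ m) * binom m j * binom (j ℕ.+ m ∸ 1) ν * binom (j ℕ.+ m ∸ 1 ∸ ν) L
                         * ℕ→ℚ (j ℕ.+ m) * x ^ℚ (j ℕ.+ m ∸ 1 ∸ (ν ℕ.+ L)))
    ≡⟨ cong (½ *_) (Σ<-cong (suc m) (λ j → cong₂
         (λ n e → sgn (j ℕ.+ m) * binom m j * binom (j ℕ.+ m ∸ 1) ν * binom n L * ℕ→ℚ (j ℕ.+ m) * x ^ℚ e)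
         (m∸n∸o≡m∸o∸n (j ℕ.+ m) 1 ν) (exponent j))) ⟩
  ½ * Σ< (suc m) (λ j → sgn (j ℕ.+ m) * binom m j * binom (j ℕ.+ m ∸ 1) ν
          * binom (j ℕ.+ m ∸ ν ∸ 1) L * ℕ→ℚ (j ℕ.+ m) * (x ^ℚ j)) ∎
  where
  open ≡-Reasoning
  L = m ∸ ν ∸ 1
  ν+L≡m' : ν ℕ.+ L ≡ m'
  ν+L≡m' = trans (cong (ν ℕ.+_) (m∸n∸o≡m∸o∸n m ν 1)) (ℕₚ.m+[n∸m]≡n ν≤m')
  B-index : ∀ k → k ℕ.+ m ∸ (ν ℕ.+ L) ≡ suc k
  B-index k = trans (cong (k ℕ.+ m ∸_) ν+L≡m') (trans (cong (_∸ m') (ℕₚ.+-suc k m')) (ℕₚ.m+n∸n≡m (suc k) m'))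
  exponent : ∀ j → j ℕ.+ m ∸ 1 ∸ (ν ℕ.+ L) ≡ j
  exponent j = trans (cong (j ℕ.+ m ∸ 1 ∸_) ν+L≡m') (trans (cong (λ n → n ∸ 1 ∸ m') (ℕₚ.+-suc j m')) (ℕₚ.m+n∸n≡m j m'))

bernoulli-identity-B[k-ℓ] : ∀ (m ν ℓ : ℕ) → 1 ≤ m → ν ≤ m → ℓ ≤ m → ∀ (x : ℚ) →
  ΣOdd m ℓ (m ∸ 1) (λ k → binom m k * binom (k ℕ.+ m) ν * binom (k ℕ.+ m ∸ ν) (ℓ ℕ.+ m ∸ ν) * B (k ∸ ℓ) x)
  ≡ ½ * ΣFromTo ℓ (m ∸ 1) (λ j → sgn (j ℕ.+ m ℕ.+ 1) * binom m (j ℕ.+ 1) * binom (j ℕ.+ m) ν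
          * binom (j ℕ.+ m ∸ ν) (ℓ ℕ.+ m ∸ ν) * ℕ→ℚ (j ℕ.+ m ℕ.+ 1) * (x ^ℚ (j ∸ ℓ)))
bernoulli-identity-B[k-ℓ] m@(suc m') ν ℓ _ ν≤m ℓ≤m x = begin
  Σ< (m ∸ ℓ) (λ i → if isOdd (ℓ ℕ.+ i ℕ.+ m) then term (ℓ ℕ.+ i) (ℓ ℕ.+ i ∸ ℓ) else 0ℚ)
    ≡⟨ Σ<-cong (m ∸ ℓ) (λ i → cong (λ e → if isOdd (ℓ ℕ.+ i ℕ.+ m) then term (ℓ ℕ.+ i) e else 0ℚ) (B-index (ℓ ℕ.+ i))) ⟩
  Σ< (m ∸ ℓ) (λ i → F (ℓ ℕ.+ i))           ≡⟨ sym (Σ<-vanishing-head F ℓ≤m F-head≗0) ⟩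
  Σ< m F                                   ≡⟨ bernoulli-odd-sum-binom² m ν L x ⟩
  ½ * Σ< (suc m) G                         ≡⟨ cong (½ *_) G-shift ⟩
  ½ * Σ< (m ∸ ℓ) (λ i → G (suc (ℓ ℕ.+ i)))  ≡⟨ cong (½ *_) (Σ<-cong (m ∸ ℓ) (λ i → G-suc (ℓ ℕ.+ i))) ⟩
  ½ * Σ< (m ∸ ℓ) (λ i → rhs (ℓ ℕ.+ i))      ∎
  where
  open ≡-Reasoning
  L = ℓ ℕ.+ m ∸ ν
  ν+L≡ℓ+m : ν ℕ.+ L ≡ ℓ ℕ.+ m
  ν+L≡ℓ+m = ℕₚ.m+[n∸m]≡n (ℕₚ.≤-trans ν≤m (ℕₚ.m≤n+m m ℓ))
  B-index : ∀ k → k ∸ ℓ ≡ k ℕ.+ m ∸ (ν ℕ.+ L)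
  B-index k = sym (trans (cong (k ℕ.+ m ∸_) ν+L≡ℓ+m)
                         (trans (cong₂ _∸_ (ℕₚ.+-comm k m) (ℕₚ.+-comm ℓ m)) (ℕₚ.[m+n]∸[m+o]≡n∸o m k ℓ)))
  below-ν+L : ∀ {n} → n < ℓ ℕ.+ m → binom n ν * binom (n ∸ ν) L ≡ 0ℚ
  below-ν+L {n} n<ℓ+m = binom-subset-vanish {n} {ν} {L} (subst (n <_) (sym ν+L≡ℓ+m) n<ℓ+m)
  vanish : ∀ a b c d → b * c ≡ 0ℚ → a * b * c * d ≡ 0ℚ
  vanish a b c d bc≡0 = trans (solve 4 (λ a b c d → a :* b :* c :* d := a :* (b :* c) :* d) refl a b c d)
    (trans (cong (λ z → a * z * d) bc≡0) (solve 2 (λ a d → a :* con 0ℚ :* d := con 0ℚ) refl a d))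
  term : ℕ → ℕ → ℚ
  term k e = binom m k * binom (k ℕ.+ m) ν * binom (k ℕ.+ m ∸ ν) L * B e x
  F : ℕ → ℚ
  F k = if isOdd (k ℕ.+ m) then term k (k ℕ.+ m ∸ (ν ℕ.+ L)) else 0ℚ
  F-head≗0 : ∀ k → k < ℓ → F k ≡ 0ℚ
  F-head≗0 k k<ℓ with isOdd (k ℕ.+ m)
  ... | true  = vanish (binom m k) (binom (k ℕ.+ m) ν) (binom (k ℕ.+ m ∸ ν) L) (B (k ℕ.+ m ∸ (ν ℕ.+ L)) x)
                       (below-ν+L (ℕₚ.+-monoˡ-< m k<ℓ))
  ... | false = refl
  G : ℕ → ℚ
  G j = sgn (j ℕ.+ m) * binom m j * binom (j ℕ.+ m ∸ 1) ν * binom (j ℕ.+ m ∸ 1 ∸ ν) L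
        * ℕ→ℚ (j ℕ.+ m) * x ^ℚ (j ℕ.+ m ∸ 1 ∸ (ν ℕ.+ L))
  G≗0 : ∀ j → j ℕ.+ m ∸ 1 < ℓ ℕ.+ m → G j ≡ 0ℚ
  G≗0 j n<ℓ+m = trans (cong (_* x ^ℚ (n ∸ (ν ℕ.+ L)))
                            (vanish (sgn (j ℕ.+ m) * binom m j) (binom n ν) (binom (n ∸ ν) L) (ℕ→ℚ (j ℕ.+ m)) (below-ν+L n<ℓ+m)))
                      (*-zeroˡ (x ^ℚ (n ∸ (ν ℕ.+ L))))
    where n = j ℕ.+ m ∸ 1
  G-shift : Σ< (suc m) G ≡ Σ< (m ∸ ℓ) (λ i → G (suc (ℓ ℕ.+ i)))
  G-shift = begin
    Σ< (suc m) G                         ≡⟨ Σ<-suc-head m G ⟩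
    G 0 + Σ< m (λ j → G (suc j))         ≡⟨ cong (_+ Σ< m (λ j → G (suc j))) (G≗0 0 (ℕₚ.<-≤-trans (ℕₚ.n<1+n m') (ℕₚ.m≤n+m m ℓ))) ⟩
    0ℚ + Σ< m (λ j → G (suc j))          ≡⟨ +-identityˡ _ ⟩
    Σ< m (λ j → G (suc j))               ≡⟨ Σ<-vanishing-head (λ j → G (suc j)) ℓ≤m (λ j j<ℓ → G≗0 (suc j) (ℕₚ.+-monoˡ-< m j<ℓ)) ⟩
    Σ< (m ∸ ℓ) (λ i → G (suc (ℓ ℕ.+ i))) ∎
  rhs : ℕ → ℚ
  rhs j = sgn (j ℕ.+ m ℕ.+ 1) * binom m (j ℕ.+ 1) * binom (j ℕ.+ m) ν
          * binom (j ℕ.+ m ∸ ν) L * ℕ→ℚ (j ℕ.+ m ℕ.+ 1) * (x ^ℚ (j ∸ ℓ))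
  G-suc : ∀ j → G (suc j) ≡ rhs j
  G-suc j = trans
    (cong₂ (λ n e → sgn n * binom m (suc j) * binom (j ℕ.+ m) ν * binom (j ℕ.+ m ∸ ν) L * ℕ→ℚ n * x ^ℚ e)
           (sym (ℕₚ.+-comm (j ℕ.+ m) 1)) (sym (B-index j)))
    (cong (λ k → sgn (j ℕ.+ m ℕ.+ 1) * binom m k * binom (j ℕ.+ m) ν * binom (j ℕ.+ m ∸ ν) L
                 * ℕ→ℚ (j ℕ.+ m ℕ.+ 1) * (x ^ℚ (j ∸ ℓ)))
          (sym (ℕₚ.+-comm j 1)))

theorem1p1 :
    (∀ (m ν : ℕ) → 1 ≤ m → ν ≤ m → ∀ (x : ℚ) →
      ΣOdd m 0 (m ∸ 1) (λ k → binom m k * binom (k ℕ.+ m) ν * binom (k ℕ.+ m ∸ ν) (m ∸ ν) * B k x)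
      ≡ ½ * ΣFromTo 0 (m ∸ 1) (λ j → sgn (j ℕ.+ m ℕ.+ 1) * binom m (j ℕ.+ 1) * binom (j ℕ.+ m) ν
              * binom (j ℕ.+ m ∸ ν) (m ∸ ν) * ℕ→ℚ (j ℕ.+ m ℕ.+ 1) * (x ^ℚ j)))
    ×
    (∀ (m ν : ℕ) → 1 ≤ m → ν ≤ m ∸ 1 → ∀ (x : ℚ) →
      ΣOdd m 0 (m ∸ 1) (λ k → binom m k * binom (k ℕ.+ m) ν * binom (k ℕ.+ m ∸ ν) (m ∸ ν ∸ 1) * B (ℕ.suc k) x)
      ≡ ½ * ΣFromTo 0 m (λ j → sgn (j ℕ.+ m) * binom m j * binom (j ℕ.+ m ∸ 1) ν
              * binom (j ℕ.+ m ∸ ν ∸ 1) (m ∸ ν ∸ 1) * ℕ→ℚ (j ℕ.+ m) * (x ^ℚ j)))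
    ×
    (∀ (m ν ℓ : ℕ) → 1 ≤ m → ν ≤ m ∸ 1 → ℓ ≤ m ∸ ν ∸ 1 → ∀ (x : ℚ) →
      ΣOdd m 0 (m ∸ 1) (λ k → binom m k * binom (k ℕ.+ m) ν * binom (k ℕ.+ m ∸ ν) ℓ * B (k ℕ.+ m ∸ ν ∸ ℓ) x)
      ≡ ½ * ΣFromTo 0 m (λ j → sgn (j ℕ.+ m) * binom m j * binom (j ℕ.+ m ∸ 1) ν
              * binom (j ℕ.+ m ∸ ν ∸ 1) ℓ * ℕ→ℚ (j ℕ.+ m) * (x ^ℚ (j ℕ.+ m ∸ ν ∸ ℓ ∸ 1))))
    ×
    (∀ (m ν ℓ : ℕ) → 1 ≤ m → ν ≤ m → ℓ ≤ m ∸ 1 → ∀ (x : ℚ) →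
      ΣOdd m ℓ (m ∸ 1) (λ k → binom m k * binom (k ℕ.+ m) ν * binom (k ℕ.+ m ∸ ν) (ℓ ℕ.+ m ∸ ν) * B (k ∸ ℓ) x)
      ≡ ½ * ΣFromTo ℓ (m ∸ 1) (λ j → sgn (j ℕ.+ m ℕ.+ 1) * binom m (j ℕ.+ 1) * binom (j ℕ.+ m) ν
              * binom (j ℕ.+ m ∸ ν) (ℓ ℕ.+ m ∸ ν) * ℕ→ℚ (j ℕ.+ m ℕ.+ 1) * (x ^ℚ (j ∸ ℓ))))
theorem1p1 =
    (λ m ν 1≤m ν≤m → bernoulli-identity-B[k-ℓ] m ν 0 1≤m ν≤m z≤n)
  , bernoulli-identity-B[k+1]
  , (λ m ν ℓ 1≤m _ _ → bernoulli-identity-B[k+m-ν-ℓ] m ν ℓ 1≤m)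
  , (λ m ν ℓ 1≤m ν≤m ℓ≤m∸1 → bernoulli-identity-B[k-ℓ] m ν ℓ 1≤m ν≤m (ℕₚ.≤-trans ℓ≤m∸1 (ℕₚ.m∸n≤m m 1)))
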